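{- For every prime $m\neq 2$, the Cartesian product graph $\Gamma(\mathbb{Z}_6)\times\Gamma(\mathbb{Z}_{2m})$ admits a distance antimagic labeling.
   Context: For an integer $n \geq 2$, the zero-divisor graph $\Gamma(\mathbb{Z}_n)$ is the simple graph whose vertex set is the set of nonzero zero-divisors of the ring $\mathbb{Z}_n$, two distinct vertices $u,v$ being adjacent iff $uv \equiv 0 \pmod n$. The Cartesian product $G\times H$ has vertex set $V(G)\times V(H)$, with $(u,v)$ adjacent to $(u',v')$ iff either $u=u'$ and $vv'\in E(H)$, or $v=v'$ and $uu'\in E(G)$. A distance antimagic labeling (DAML) of a graph $G$ with $N$ vertices is a bijection $f:V(G)\to\{1,\dots,N\}$ such that the weights $w(v)=\sum_{u\in N(v)} f(u)$, where $N(v)$ is the open neighbourhood of $v$, are pairwise distinct over all vertices $v$. A graph admits DAML if such a labeling exists. -}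

module Defs where

open import Data.Bool using (Bool; true; false; _∧_; _∨_; not)
open import Data.Nat using (ℕ; suc; _*_; _+_)
open import Data.Nat.Divisibility using (_∣?_)
open import Data.List using (List; []; _∷_; map; filterᵇ; upTo; cartesianProduct; length)
open import Data.Bool.ListAction using (any)
open import Data.Nat.ListAction using (sum)
open import Data.List.Membership.Propositional using (_∈_)
open import Data.List.Relation.Binary.Permutation.Propositional using (_↭_)
open import Data.Product using (_×_; _,_; Σ-syntax)
open import Relation.Nullary using (¬_; does)
open import Relation.Binary.Definitions using (DecidableEquality)
open import Relation.Binary.PropositionalEquality using (_≡_)
import Data.Nat as ℕ
import Data.Product.Properties as ×P

-- A finite simple graph given by an explicit (duplicate-free) list of
-- vertices and a Boolean adjacency relation.
record Graph : Set₁ where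
  field
    V        : Set
    _≟V_     : DecidableEquality V
    vertices : List V
    adj      : V → V → Bool
open Graph public

nonzeroResidues : ℕ → List ℕ
nonzeroResidues n = filterᵇ (λ x → not (x ℕ.≡ᵇ 0)) (upTo n)

≡0mod : ℕ → ℕ → Bool
≡0mod n x = does (n ∣? x)

isZeroDivisor : ℕ → ℕ → Bool
isZeroDivisor n x = any (λ y → ≡0mod n (x * y)) (nonzeroResidues n)

Γℤ : ℕ → Graph
Γℤ n = record
  { V        = ℕ
  ; _≟V_     = ℕ._≟_
  ; vertices = filterᵇ (isZeroDivisor n) (nonzeroResidues n)
  ; adj      = λ u v → not (u ℕ.≡ᵇ v) ∧ ≡0mod n (u * v)
  }

_□_ : Graph → Graph → Graph
G □ H = record
  { V        = V G × V H
  ; _≟V_     = ×P.≡-dec (_≟V_ G) (_≟V_ H)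
  ; vertices = cartesianProduct (vertices G) (vertices H)
  ; adj      = λ { (u , v) (u′ , v′) →
                   (does (_≟V_ G u u′) ∧ adj H v v′) ∨ (does (_≟V_ H v v′) ∧ adj G u u′) }
  }

weight : (G : Graph) → (V G → ℕ) → V G → ℕ
weight G f v = sum (map f (filterᵇ (adj G v) (vertices G)))

-- f is a bijection V(G) → {1,…,N}: since the vertex list is duplicate-free,
-- this is the statement that the list of labels is a permutation of [1..N].
IsLabeling : (G : Graph) → (V G → ℕ) → Set
IsLabeling G f = map f (vertices G) ↭ map suc (upTo (length (vertices G)))

IsDAML : (G : Graph) → (V G → ℕ) → Set
IsDAML G f = IsLabeling G f ×
  (∀ u v → u ∈ vertices G → v ∈ vertices G → ¬ u ≡ v → ¬ weight G f u ≡ weight G f v)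

AdmitsDAML : Graph → Set
AdmitsDAML G = Σ[ f ∈ (V G → ℕ) ] IsDAML G f

-- Γ(ℤ₆) is the path 2 — 3 — 4 and, for an odd prime m = n + 1, Γ(ℤ₂ₘ) is the star with centre m
-- and leaves 2i (1 ≤ i ≤ n). In a Cartesian product the weight of a vertex is its weight inside its
-- row plus its weight inside its column, so under the labelling below every weight is an explicit
-- polynomial in n, affine in i at the leaves. For m ≥ 5 these weights fall into six consecutive
-- disjoint ranges (leaves of rows 2, 4, 3, then centres of rows 3, 2, 4), inside each of which they
-- determine the vertex; for m = 3 the nine weights are compared directly.
module Submission where

open import Defs
open import Data.Nat using (ℕ; _*_)
open import Data.Nat.Primality using (Prime)
open import Relation.Nullary using (¬_)
open import Relation.Binary.PropositionalEquality using (_≡_)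

open import Data.Bool using (Bool; true; false; T; not; _∧_; _∨_; if_then_else_)
open import Data.Bool.Properties using (T-≡; ∧-zeroʳ; ∨-identityʳ; if-∧)
open import Data.List
  using (List; []; _∷_; _++_; [_]; map; concatMap; filterᵇ; cartesianProduct; upTo; applyUpTo; length)
open import Data.List.Properties
  using (map-++; map-∘; map-cong; map-upTo; length-map; ++-identityʳ; filter-all; filter-none; filter-accept; filter-reject)
open import Data.List.Membership.Propositional using (_∈_; _∉_; find; lose)
open import Data.List.Membership.Propositional.Properties
  using (∈-filter⁺; ∈-filter⁻; ∈-upTo⁺; ∈-upTo⁻; ∈-map⁺; ∈-map⁻; ∈-cartesianProduct⁻)
open import Data.List.Membership.Propositional.Properties.WithK using (unique∧set⇒bag)
open import Data.List.Relation.Unary.Any using (here; there)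
open import Data.List.Relation.Unary.Any.Properties using (any⁺; any⁻)
import Data.List.Relation.Unary.All as All
open import Data.List.Relation.Unary.AllPairs using ([]; _∷_)
open import Data.List.Relation.Unary.Unique.Propositional using (Unique)
import Data.List.Relation.Unary.Unique.Propositional.Properties as Unique
open import Data.List.Relation.Binary.BagAndSetEquality using (∼bag⇒↭)
open import Data.List.Relation.Binary.Permutation.Propositional
  using (_↭_; ↭-refl; ↭-sym; ↭-trans; ↭-reflexive; prep; module PermutationReasoning)
import Data.List.Relation.Binary.Permutation.Propositional.Properties as ↭
open import Data.Nat using (zero; suc; _+_; _<_; _≤_; _≤′_; ≤′-refl; ≤′-step; _≟_; ⌊_/2⌋;
  z≤n; s≤s; z<s; >-nonZero; nonTrivial⇒n>1)
import Data.Nat as ℕ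
open import Data.List.Relation.Unary.Unique.DecPropositional ℕ._≟_ using (unique?)
open import Data.Nat.Divisibility using (_∣_; _∣?_; divides; ∣-refl; ∣-reflexive; ∣-trans; ∣⇒≤;
  m∣m*n; n∣m*n; *-pres-∣; *-cancelʳ-∣)
open import Data.Nat.ListAction using (sum)
open import Data.Nat.ListAction.Properties using (sum-++; sum-↭)
open import Data.Nat.Primality
  using (euclidsLemma; prime[2]; prime⇒irreducible; prime⇒nonTrivial; ¬prime[0]; ¬prime[1])
open import Data.Nat.Properties
open import Algebra.Properties.CommutativeSemigroup +-commutativeSemigroup using (interchange)
open import Data.Nat.Tactic.RingSolver using (solve-∀)
open import Data.Product using (_×_; _,_; ∃-syntax; proj₁; proj₂)
open import Data.Sum using (inj₁; inj₂)
open import Data.Unit using (⊤; tt)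
open import Function using (_∘_; case_of_; mk⇔; Equivalence)
open import Relation.Binary.Definitions using (DecidableEquality; tri<; tri≈; tri>)
open import Relation.Binary.PropositionalEquality hiding ([_])
open import Relation.Nullary using (Dec; does; yes; no; contradiction)
open import Relation.Nullary.Decidable using (T?; dec-true; dec-false; from-yes)

private variable
  A B C : Set

sum-map-filterᵇ : (p : A → Bool) (f : A → ℕ) (xs : List A) →
                  sum (map f (filterᵇ p xs)) ≡ sum (map (λ x → if p x then f x else 0) xs)
sum-map-filterᵇ p f []       = refl
sum-map-filterᵇ p f (x ∷ xs) with p x
... | true  = cong (f x +_) (sum-map-filterᵇ p f xs)
... | false = sum-map-filterᵇ p f xs

sum-map-+ : (f g : A → ℕ) (xs : List A) →
            sum (map (λ x → f x + g x) xs) ≡ sum (map f xs) + sum (map g xs)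
sum-map-+ f g []       = refl
sum-map-+ f g (x ∷ xs) =
  trans (cong (f x + g x +_) (sum-map-+ f g xs)) (interchange (f x) (g x) (sum (map f xs)) (sum (map g xs)))

map-cartesianProduct : (g : A × B → C) (xs : List A) (ys : List B) →
                       map g (cartesianProduct xs ys) ≡ concatMap (λ x → map (λ y → g (x , y)) ys) xs
map-cartesianProduct g []       ys = refl
map-cartesianProduct g (x ∷ xs) ys =
  trans (map-++ g (map (x ,_) ys) _) (cong₂ _++_ (sym (map-∘ ys)) (map-cartesianProduct g xs ys))

sum-map-cartesianProduct : (f : A × B → ℕ) (xs : List A) (ys : List B) →
                           sum (map f (cartesianProduct xs ys)) ≡
                           sum (map (λ x → sum (map (λ y → f (x , y)) ys)) xs)
sum-map-cartesianProduct f []       ys = refl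
sum-map-cartesianProduct f (x ∷ xs) ys = begin
  sum (map f (map (x ,_) ys ++ cartesianProduct xs ys))
    ≡⟨ cong sum (map-++ f (map (x ,_) ys) _) ⟩
  sum (map f (map (x ,_) ys) ++ map f (cartesianProduct xs ys))
    ≡⟨ sum-++ (map f (map (x ,_) ys)) _ ⟩
  sum (map f (map (x ,_) ys)) + sum (map f (cartesianProduct xs ys))
    ≡⟨ cong₂ _+_ (cong sum (sym (map-∘ ys))) (sum-map-cartesianProduct f xs ys) ⟩
  sum (map (λ y → f (x , y)) ys) + sum (map (λ x → sum (map (λ y → f (x , y)) ys)) xs) ∎
  where open ≡-Reasoning

module _ (_≟A_ : DecidableEquality A) (h : A → ℕ) where

  sum-map-if-≟-∉ : ∀ {x xs} → x ∉ xs → sum (map (λ y → if does (x ≟A y) then h y else 0) xs) ≡ 0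
  sum-map-if-≟-∉ {x} {[]}     x∉ = refl
  sum-map-if-≟-∉ {x} {y ∷ xs} x∉ with x ≟A y
  ... | yes refl = contradiction (here refl) x∉
  ... | no _     = sum-map-if-≟-∉ (x∉ ∘ there)

  sum-map-if-≟ : ∀ {x xs} → Unique xs → x ∈ xs →
                 sum (map (λ y → if does (x ≟A y) then h y else 0) xs) ≡ h x
  sum-map-if-≟ {x} (x∉ ∷ _) (here refl) with x ≟A x
  ... | yes _  = trans (cong (h x +_) (sum-map-if-≟-∉ (λ x∈ → All.lookup x∉ x∈ refl))) (+-identityʳ (h x))
  ... | no x≢x = contradiction refl x≢x
  sum-map-if-≟ {x} {y ∷ _} (y∉ ∷ uniq) (there x∈) with x ≟A y
  ... | yes refl = contradiction refl (All.lookup y∉ x∈)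
  ... | no _     = sum-map-if-≟ uniq x∈

same-elements⇒↭ : {xs ys : List A} → Unique xs → Unique ys →
                  (∀ {x} → x ∈ xs → x ∈ ys) → (∀ {x} → x ∈ ys → x ∈ xs) → xs ↭ ys
same-elements⇒↭ uxs uys xs⊆ys ys⊆xs = ∼bag⇒↭ (unique∧set⇒bag uxs uys (mk⇔ xs⊆ys ys⊆xs))

unique-map⇒injective : {f : A → B} {xs : List A} → Unique (map f xs) →
                       ∀ {x y} → x ∈ xs → y ∈ xs → f x ≡ f y → x ≡ y
unique-map⇒injective         _          (here refl) (here refl) _  = refl
unique-map⇒injective {f = f} (fz∉ ∷ _)  (here refl) (there y∈)  eq = contradiction eq (All.lookup fz∉ (∈-map⁺ f y∈))
unique-map⇒injective {f = f} (fz∉ ∷ _)  (there x∈)  (here refl) eq = contradiction (sym eq) (All.lookup fz∉ (∈-map⁺ f x∈))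
unique-map⇒injective         (_ ∷ uniq) (there x∈)  (there y∈)  eq = unique-map⇒injective uniq x∈ y∈ eq

rearrange : (x y z : A) (X Y Z : List A) →
            (x ∷ X) ++ (y ∷ Y) ++ (z ∷ Z) ++ [] ↭ Y ++ X ++ x ∷ y ∷ Z ++ [ z ]
rearrange x y z X Y Z = begin
  x ∷ X ++ y ∷ Y ++ z ∷ Z ++ []   ↭⟨ prep x (↭.++⁺ˡ X (prep y (↭.++⁺ˡ Y z∷Z↭Z∷ʳz))) ⟩
  x ∷ X ++ y ∷ Y ++ Z ++ [ z ]    ↭⟨ prep x (↭.++⁺ˡ X (↭-sym (↭.shift y Y _))) ⟩
  x ∷ X ++ Y ++ y ∷ Z ++ [ z ]    ↭⟨ prep x (↭.shifts X Y) ⟩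
  x ∷ Y ++ X ++ y ∷ Z ++ [ z ]    ↭⟨ ↭-sym (↭.shift x Y _) ⟩
  Y ++ x ∷ X ++ y ∷ Z ++ [ z ]    ↭⟨ ↭.++⁺ˡ Y (↭-sym (↭.shift x X _)) ⟩
  Y ++ X ++ x ∷ y ∷ Z ++ [ z ]    ∎
  where
  open PermutationReasoning
  z∷Z↭Z∷ʳz : z ∷ Z ++ [] ↭ Z ++ [ z ]
  z∷Z↭Z∷ʳz = ↭-trans (prep z (↭-reflexive (++-identityʳ Z))) (↭.∷↭∷ʳ z Z)

-- Intervals s + 1, …, s + k

interval : ℕ → ℕ → List ℕ
interval s zero    = []
interval s (suc k) = suc s ∷ interval (suc s) k

∈-interval⁻ : ∀ s k {x} → x ∈ interval s k → s < x × x ≤ s + k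
∈-interval⁻ s (suc k) (here refl) = n<1+n s , ≤-trans (s≤s (m≤m+n s k)) (≤-reflexive (sym (+-suc s k)))
∈-interval⁻ s (suc k) (there x∈) with ∈-interval⁻ (suc s) k x∈
... | s+1<x , x≤s+1+k = <-trans (n<1+n s) s+1<x , ≤-trans x≤s+1+k (≤-reflexive (sym (+-suc s k)))

∈-interval⁺ : ∀ s k {x} → s < x → x ≤ s + k → x ∈ interval s k
∈-interval⁺ s zero        s<x x≤s+0   = contradiction (≤-trans x≤s+0 (≤-reflexive (+-identityʳ s))) (<⇒≱ s<x)
∈-interval⁺ s (suc k) {x} s<x x≤s+k+1 with x ≟ suc s
... | yes refl = here refl
... | no x≢s+1 = there (∈-interval⁺ (suc s) k (≤∧≢⇒< s<x (x≢s+1 ∘ sym)) (≤-trans x≤s+k+1 (≤-reflexive (+-suc s k))))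

interval-unique : ∀ s k → Unique (interval s k)
interval-unique s zero    = []
interval-unique s (suc k) =
  All.tabulate (λ x∈ s+1≡x → <-irrefl s+1≡x (proj₁ (∈-interval⁻ (suc s) k x∈))) ∷ interval-unique (suc s) k

length-interval : ∀ s k → length (interval s k) ≡ k
length-interval s zero    = refl
length-interval s (suc k) = cong suc (length-interval (suc s) k)

interval-++ : ∀ s a b → interval s (a + b) ≡ interval s a ++ interval (s + a) b
interval-++ s zero    b = cong (λ t → interval t b) (sym (+-identityʳ s))
interval-++ s (suc a) b =
  cong (suc s ∷_) (trans (interval-++ (suc s) a b) (cong (λ t → interval (suc s) a ++ interval t b) (sym (+-suc s a))))

map-+-interval : ∀ c s k → map (c +_) (interval s k) ≡ interval (c + s) k
map-+-interval c s zero    = refl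
map-+-interval c s (suc k) =
  cong₂ _∷_ (+-suc c s) (trans (map-+-interval c (suc s) k) (cong (λ t → interval t k) (+-suc c s)))

applyUpTo-interval : ∀ (f : ℕ → ℕ) s k → (∀ i → f i ≡ suc (s + i)) → applyUpTo f k ≡ interval s k
applyUpTo-interval f s zero    f≗ = refl
applyUpTo-interval f s (suc k) f≗ =
  cong₂ _∷_ (trans (f≗ 0) (cong suc (+-identityʳ s)))
            (applyUpTo-interval (f ∘ suc) (suc s) k (λ i → trans (f≗ (suc i)) (cong suc (+-suc s i))))

upTo-interval : ∀ k → map suc (upTo k) ≡ interval 0 k
upTo-interval k = trans (map-upTo suc k) (applyUpTo-interval suc 0 k (λ _ → refl))

sum-interval : ∀ s k → 2 * sum (interval s k) ≡ k * suc (s + s + k)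
sum-interval s zero    = refl
sum-interval s (suc k) = begin
  2 * (suc s + sum (interval (suc s) k))     ≡⟨ *-distribˡ-+ 2 (suc s) _ ⟩
  2 * suc s + 2 * sum (interval (suc s) k)   ≡⟨ cong (2 * suc s +_) (sum-interval (suc s) k) ⟩
  2 * suc s + k * suc (suc s + suc s + k)    ≡⟨ e s k ⟩
  suc k * suc (s + s + suc k)                ∎
  where
  open ≡-Reasoning
  e : ∀ s k → 2 * suc s + k * suc (suc s + suc s + k) ≡ suc k * suc (s + s + suc k)
  e = solve-∀

HasDistinctWeights : (G : Graph) → (V G → ℕ) → Set
HasDistinctWeights G f =
  ∀ u v → u ∈ vertices G → v ∈ vertices G → ¬ u ≡ v → ¬ weight G f u ≡ weight G f v

weight-cong : (G : Graph) {g g′ : V G → ℕ} → (∀ x → g x ≡ g′ x) → ∀ x → weight G g x ≡ weight G g′ x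
weight-cong G g≗g′ x = cong sum (map-cong g≗g′ (filterᵇ (adj G x) (vertices G)))

weight-□ : (G H : Graph) (f : V G × V H → ℕ) {u : V G} {v : V H} →
           Unique (vertices G) → Unique (vertices H) → u ∈ vertices G → v ∈ vertices H →
           adj G u u ≡ false →
           weight (G □ H) f (u , v) ≡ weight H (λ y → f (u , y)) v + weight G (λ x → f (x , v)) u
weight-□ G H f {u} {v} uniqG uniqH u∈ v∈ u≁u = begin
  weight (G □ H) f (u , v)
    ≡⟨ sum-map-filterᵇ _ f (cartesianProduct (vertices G) (vertices H)) ⟩
  sum (map (λ z → if adj (G □ H) (u , v) z then f z else 0) (cartesianProduct (vertices G) (vertices H)))
    ≡⟨ sum-map-cartesianProduct _ (vertices G) (vertices H) ⟩
  sum (map (λ x → sum (map (λ y → if adj (G □ H) (u , v) (x , y) then f (x , y) else 0) (vertices H))) (vertices G))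
    ≡⟨ cong sum (map-cong row (vertices G)) ⟩
  sum (map (λ x → (if does (_≟V_ G u x) then rowSum x else 0) + (if adj G u x then f (x , v) else 0)) (vertices G))
    ≡⟨ sum-map-+ _ _ (vertices G) ⟩
  sum (map (λ x → if does (_≟V_ G u x) then rowSum x else 0) (vertices G)) +
  sum (map (λ x → if adj G u x then f (x , v) else 0) (vertices G))
    ≡⟨ cong₂ _+_ (sum-map-if-≟ (_≟V_ G) rowSum uniqG u∈) (sym (sum-map-filterᵇ (adj G u) _ (vertices G))) ⟩
  rowSum u + weight G (λ x → f (x , v)) u
    ≡⟨ cong (_+ weight G (λ x → f (x , v)) u) (sym (sum-map-filterᵇ (adj H v) _ (vertices H))) ⟩
  weight H (λ y → f (u , y)) v + weight G (λ x → f (x , v)) u ∎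
  where
  open ≡-Reasoning
  rowSum : V G → ℕ
  rowSum x = sum (map (λ y → if adj H v y then f (x , y) else 0) (vertices H))
  row : ∀ x → sum (map (λ y → if (does (_≟V_ G u x) ∧ adj H v y) ∨ (does (_≟V_ H v y) ∧ adj G u x)
                              then f (x , y) else 0) (vertices H)) ≡
              (if does (_≟V_ G u x) then rowSum x else 0) + (if adj G u x then f (x , v) else 0)
  row x with _≟V_ G u x
  ... | yes refl rewrite u≁u =
    trans (cong sum (map-cong (λ y → cong (λ b → if b then f (u , y) else 0)
                                          (trans (cong (adj H v y ∨_) (∧-zeroʳ _)) (∨-identityʳ _)))
                              (vertices H)))
          (sym (+-identityʳ (rowSum u)))
  ... | no _ =
    trans (cong sum (map-cong (λ y → if-∧ (does (_≟V_ H v y))) (vertices H)))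
          (sum-map-if-≟ (_≟V_ H) (λ y → if adj G u x then f (x , y) else 0) uniqH v∈)

≡false⇒¬T : ∀ {b} → b ≡ false → ¬ T b
≡false⇒¬T refl ()

module Star (G : Graph) (c : V G) (leaves : List (V G))
            (vertices↭ : vertices G ↭ c ∷ leaves)
            (c≁c : adj G c c ≡ false)
            (c∼leaf : ∀ {x} → x ∈ leaves → adj G c x ≡ true)
            (leaf∼c : ∀ {x} → x ∈ leaves → adj G x c ≡ true)
            (leaf≁leaf : ∀ {x y} → x ∈ leaves → y ∈ leaves → adj G x y ≡ false) where

  weight-↭ : (h : V G → ℕ) (x : V G) → weight G h x ≡ sum (map h (filterᵇ (adj G x) (c ∷ leaves)))
  weight-↭ h x = sum-↭ (↭.map⁺ h (↭.filter-↭ _ vertices↭))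

  weight-centre : (h : V G → ℕ) → weight G h c ≡ sum (map h leaves)
  weight-centre h = begin
    weight G h c
      ≡⟨ weight-↭ h c ⟩
    sum (map h (filterᵇ (adj G c) (c ∷ leaves)))
      ≡⟨ cong (sum ∘ map h) (filter-reject (T? ∘ adj G c) (≡false⇒¬T c≁c)) ⟩
    sum (map h (filterᵇ (adj G c) leaves))
      ≡⟨ cong (sum ∘ map h) (filter-all (T? ∘ adj G c) (All.tabulate (Equivalence.from T-≡ ∘ c∼leaf))) ⟩
    sum (map h leaves) ∎
    where open ≡-Reasoning

  weight-leaf : (h : V G → ℕ) {x : V G} → x ∈ leaves → weight G h x ≡ h c
  weight-leaf h {x} x∈ = begin
    weight G h x
      ≡⟨ weight-↭ h x ⟩
    sum (map h (filterᵇ (adj G x) (c ∷ leaves)))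
      ≡⟨ cong (sum ∘ map h) (filter-accept (T? ∘ adj G x) (Equivalence.from T-≡ (leaf∼c x∈))) ⟩
    h c + sum (map h (filterᵇ (adj G x) leaves))
      ≡⟨ cong (λ ys → h c + sum (map h ys)) (filter-none (T? ∘ adj G x) (All.tabulate (≡false⇒¬T ∘ leaf≁leaf x∈))) ⟩
    h c + 0
      ≡⟨ +-identityʳ (h c) ⟩
    h c ∎
    where open ≡-Reasoning

T-does⁻ : ∀ {P : Set} (d : Dec P) → T (does d) → P
T-does⁻ (yes p) _ = p

T-does⁺ : ∀ {P : Set} (d : Dec P) → P → T (does d)
T-does⁺ d p = Equivalence.from T-≡ (dec-true d p)

∈-nonzeroResidues⁻ : ∀ {n x} → x ∈ nonzeroResidues n → 0 < x × x < n
∈-nonzeroResidues⁻ {n} {x} x∈ with ∈-filter⁻ (T? ∘ λ x → not (x ℕ.≡ᵇ 0)) {xs = upTo n} x∈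
∈-nonzeroResidues⁻ {x = suc x} x∈ | x∈upTo , _ = z<s , ∈-upTo⁻ x∈upTo

∈-nonzeroResidues⁺ : ∀ {n x} → 0 < x → x < n → x ∈ nonzeroResidues n
∈-nonzeroResidues⁺ {x = suc x} _ x<n = ∈-filter⁺ (T? ∘ λ x → not (x ℕ.≡ᵇ 0)) (∈-upTo⁺ x<n) _

∈-Γℤ⁻ : ∀ {n x} → x ∈ vertices (Γℤ n) → 0 < x × x < n × ∃[ y ] (0 < y × y < n × n ∣ x * y)
∈-Γℤ⁻ {n} {x} x∈ with ∈-filter⁻ (T? ∘ isZeroDivisor n) {xs = nonzeroResidues n} x∈
... | x∈R , zd with find (any⁻ _ (nonzeroResidues n) zd)
... | y , y∈R , n∣xy with ∈-nonzeroResidues⁻ {n} x∈R | ∈-nonzeroResidues⁻ {n} y∈R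
... | 0<x , x<n | 0<y , y<n = 0<x , x<n , y , 0<y , y<n , T-does⁻ (n ∣? (x * y)) n∣xy

∈-Γℤ⁺ : ∀ {n x} y → 0 < x → x < n → 0 < y → y < n → n ∣ x * y → x ∈ vertices (Γℤ n)
∈-Γℤ⁺ {n} {x} y 0<x x<n 0<y y<n n∣xy =
  ∈-filter⁺ (T? ∘ isZeroDivisor n) (∈-nonzeroResidues⁺ {n} 0<x x<n)
    (any⁺ _ (lose (∈-nonzeroResidues⁺ {n} 0<y y<n) (T-does⁺ (n ∣? (x * y)) n∣xy)))

Γℤ-unique : ∀ n → Unique (vertices (Γℤ n))
Γℤ-unique n = Unique.filter⁺ _ (Unique.filter⁺ _ (Unique.upTo⁺ n))

Γℤ-irreflexive : ∀ n x → adj (Γℤ n) x x ≡ false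
Γℤ-irreflexive n x rewrite Equivalence.to T-≡ (≡⇒≡ᵇ x x refl) = refl

Γℤ-adj⁺ : ∀ {n x y} → x ≢ y → n ∣ x * y → adj (Γℤ n) x y ≡ true
Γℤ-adj⁺ {n} {x} {y} x≢y n∣xy = cong₂ (λ p q → not p ∧ q) (dec-false (x ≟ y) x≢y) (dec-true (n ∣? x * y) n∣xy)

Γℤ-adj⁻ : ∀ {n x y} → ¬ n ∣ x * y → adj (Γℤ n) x y ≡ false
Γℤ-adj⁻ {n} {x} {y} n∤xy = trans (cong (not (x ℕ.≡ᵇ y) ∧_) (dec-false (n ∣? x * y) n∤xy)) (∧-zeroʳ _)

m∣n∧0<n<2m⇒n≡m : ∀ {m n} → m ∣ n → 0 < n → n < 2 * m → n ≡ m
m∣n∧0<n<2m⇒n≡m {m} (divides zero          refl) ()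
m∣n∧0<n<2m⇒n≡m {m} (divides (suc zero)    refl) _ _    = +-identityʳ m
m∣n∧0<n<2m⇒n≡m {m} (divides (suc (suc q)) refl) _ n<2m =
  contradiction (+-monoʳ-≤ m (+-monoʳ-≤ m z≤n)) (<⇒≱ n<2m)

prime≢2⇒odd : ∀ {m} → Prime m → m ≢ 2 → ¬ 2 ∣ m
prime≢2⇒odd p m≢2 2∣m with prime⇒irreducible p 2∣m
... | inj₁ ()
... | inj₂ 2≡m = m≢2 (sym 2≡m)

-- Separating the weights

module _ {X : Set} (P : X → Set) (w band : X → ℕ) (θ : ℕ → ℕ)
         (θ-step : ∀ k → θ k ≤ θ (suc k))
         (w-in-band : ∀ {x} → P x → θ (band x) ≤ w x × w x < θ (suc (band x))) where

  θ-mono : ∀ {j k} → j ≤ k → θ j ≤ θ k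
  θ-mono j≤k = go (≤⇒≤′ j≤k)
    where
    go : ∀ {j k} → j ≤′ k → θ j ≤ θ k
    go ≤′-refl        = ≤-refl
    go (≤′-step j≤′k) = ≤-trans (go j≤′k) (θ-step _)

  <-across-bands : ∀ {x y} → P x → P y → band x < band y → w x < w y
  <-across-bands px py bx<by =
    <-≤-trans (proj₂ (w-in-band px)) (≤-trans (θ-mono bx<by) (proj₁ (w-in-band py)))

  injective-by-bands : (∀ {x y} → P x → P y → band x ≡ band y → w x ≡ w y → x ≡ y) →
                       ∀ {x y} → P x → P y → w x ≡ w y → x ≡ y
  injective-by-bands same-band {x} {y} px py wx≡wy with <-cmp (band x) (band y)
  ... | tri< bx<by _ _ = contradiction wx≡wy (<⇒≢ (<-across-bands px py bx<by))
  ... | tri≈ _ bx≡by _ = same-band px py bx≡by wx≡wy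
  ... | tri> _ _ by<bx = contradiction wx≡wy (≢-sym (<⇒≢ (<-across-bands py px by<bx)))

data StarVertex : Set where
  centre : StarVertex
  leaf   : ℕ → StarVertex

IsStarVertex : ℕ → StarVertex → Set
IsStarVertex n centre   = ⊤
IsStarVertex n (leaf i) = i ∈ interval 0 n

-- (a , leaf i) stands for the vertex (a , 2i) of Γ(ℤ₆) × Γ(ℤ₂ₘ) and (a , centre) for (a , m).
Class : Set
Class = ℕ × StarVertex

IsClass : ℕ → Class → Set
IsClass n (a , c) = a ∈ 2 ∷ 3 ∷ 4 ∷ [] × IsStarVertex n c

-- Twice the weight, so that the triangular numbers in the centre weights stay integral.
doubledWeight : ℕ → Class → ℕ
doubledWeight n (2 , centre) = 3 * n * n + 5 * n + 4
doubledWeight n (3 , centre) = n * n + 11 * n + 8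
doubledWeight n (4 , centre) = 5 * n * n + 9 * n + 4
doubledWeight n (2 , leaf i) = 4 * n + 2 + 2 * i
doubledWeight n (3 , leaf i) = 10 * n + 8 + 4 * i
doubledWeight n (4 , leaf i) = 6 * n + 6 + 2 * i
doubledWeight n _            = 0

band : Class → ℕ
band (2 , leaf _) = 0
band (4 , leaf _) = 1
band (3 , leaf _) = 2
band (3 , centre) = 3
band (2 , centre) = 4
band _            = 5

bandBound : ℕ → ℕ → ℕ
bandBound n 0 = 0
bandBound n 1 = 6 * n + 8
bandBound n 2 = 10 * n + 12
bandBound n 3 = doubledWeight n (3 , centre)
bandBound n 4 = doubledWeight n (2 , centre)
bandBound n 5 = doubledWeight n (4 , centre)
bandBound n _ = suc (doubledWeight n (4 , centre))

isCentre : StarVertex → Bool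
isCentre centre   = true
isCentre (leaf _) = false

bandClass : ℕ → ℕ × Bool
bandClass 0 = 2 , false
bandClass 1 = 4 , false
bandClass 2 = 3 , false
bandClass 3 = 3 , true
bandClass 4 = 2 , true
bandClass _ = 4 , true

bandClass-band : ∀ {a} c → a ∈ 2 ∷ 3 ∷ 4 ∷ [] → bandClass (band (a , c)) ≡ (a , isCentre c)
bandClass-band centre   (here refl)                 = refl
bandClass-band centre   (there (here refl))         = refl
bandClass-band centre   (there (there (here refl))) = refl
bandClass-band (leaf _) (here refl)                 = refl
bandClass-band (leaf _) (there (here refl))         = refl
bandClass-band (leaf _) (there (there (here refl))) = refl

leaf-injective : ∀ {n a i j} → a ∈ 2 ∷ 3 ∷ 4 ∷ [] →
                 doubledWeight n (a , leaf i) ≡ doubledWeight n (a , leaf j) → i ≡ j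
leaf-injective {n} {i = i} {j} (here refl)                 eq = *-cancelˡ-≡ i j 2 (+-cancelˡ-≡ (4 * n + 2) _ _ eq)
leaf-injective {n} {i = i} {j} (there (here refl))         eq = *-cancelˡ-≡ i j 4 (+-cancelˡ-≡ (10 * n + 8) _ _ eq)
leaf-injective {n} {i = i} {j} (there (there (here refl))) eq = *-cancelˡ-≡ i j 2 (+-cancelˡ-≡ (6 * n + 6) _ _ eq)

same-band-injective : ∀ {n x y} → IsClass n x → IsClass n y → band x ≡ band y →
                      doubledWeight n x ≡ doubledWeight n y → x ≡ y
same-band-injective {x = a , c} {a′ , c′} (a∈ , _) (a′∈ , _) bx≡by w≡
  with cong proj₁ classes≡ | cong proj₂ classes≡
  where
  classes≡ : (a , isCentre c) ≡ (a′ , isCentre c′)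
  classes≡ = trans (sym (bandClass-band c a∈)) (trans (cong bandClass bx≡by) (bandClass-band c′ a′∈))
same-band-injective {x = a , centre} {.a , centre} _        _ _ _  | refl | _  = refl
same-band-injective {x = a , leaf i} {.a , leaf j} (a∈ , _) _ _ w≡ | refl | _  = cong (λ k → a , leaf k) (leaf-injective a∈ w≡)
same-band-injective {x = a , centre} {.a , leaf _} _        _ _ _  | refl | ()
same-band-injective {x = a , leaf _} {.a , centre} _        _ _ _  | refl | ()

≤-by : ∀ {a b} d → a + d ≡ b → a ≤ b
≤-by {a} d refl = m≤m+n a d

<-by : ∀ {a b} d → suc (a + d) ≡ b → a < b
<-by {a} d refl = s≤s (m≤m+n a d)

leaf-upper : ∀ b k {i n θ} → i ≤ n → b + k * n < θ → b + k * i < θ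
leaf-upper b k i≤n b+kn<θ = ≤-<-trans (+-monoʳ-≤ b (*-monoʳ-≤ k i≤n)) b+kn<θ

leaf-lower : ∀ b k {i θ} → 0 < i → θ ≤ b + k * 1 → θ ≤ b + k * i
leaf-lower b k 0<i θ≤b+k = ≤-trans θ≤b+k (+-monoʳ-≤ b (*-monoʳ-≤ k 0<i))

module _ (t : ℕ) where

  centre₃<centre₂ : doubledWeight (4 + t) (3 , centre) < doubledWeight (4 + t) (2 , centre)
  centre₃<centre₂ = <-by (2 * t * t + 10 * t + 3) (e t)
    where e : ∀ t → suc ((4 + t) * (4 + t) + 11 * (4 + t) + 8 + (2 * t * t + 10 * t + 3)) ≡ 3 * (4 + t) * (4 + t) + 5 * (4 + t) + 4
          e = solve-∀

  centre₂<centre₄ : doubledWeight (4 + t) (2 , centre) < doubledWeight (4 + t) (4 , centre)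
  centre₂<centre₄ = <-by (2 * t * t + 20 * t + 47) (e t)
    where e : ∀ t → suc (3 * (4 + t) * (4 + t) + 5 * (4 + t) + 4 + (2 * t * t + 20 * t + 47)) ≡ 5 * (4 + t) * (4 + t) + 9 * (4 + t) + 4
          e = solve-∀

  bandBound-step : ∀ k → bandBound (4 + t) k ≤ bandBound (4 + t) (suc k)
  bandBound-step 0 = z≤n
  bandBound-step 1 = ≤-by (4 * t + 20) (e t)
    where e : ∀ t → 6 * (4 + t) + 8 + (4 * t + 20) ≡ 10 * (4 + t) + 12
          e = solve-∀
  bandBound-step 2 = ≤-by (t * t + 9 * t + 16) (e t)
    where e : ∀ t → 10 * (4 + t) + 12 + (t * t + 9 * t + 16) ≡ (4 + t) * (4 + t) + 11 * (4 + t) + 8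
          e = solve-∀
  bandBound-step 3 = <⇒≤ centre₃<centre₂
  bandBound-step 4 = <⇒≤ centre₂<centre₄
  bandBound-step 5 = n≤1+n _
  bandBound-step (suc (suc (suc (suc (suc (suc _)))))) = ≤-refl

  in-band : ∀ {x} → IsClass (4 + t) x →
            bandBound (4 + t) (band x) ≤ doubledWeight (4 + t) x × doubledWeight (4 + t) x < bandBound (4 + t) (suc (band x))
  in-band {2 , centre} (here refl , _)                 = ≤-refl , centre₂<centre₄
  in-band {3 , centre} (there (here refl) , _)         = ≤-refl , centre₃<centre₂
  in-band {4 , centre} (there (there (here refl)) , _) = ≤-refl , n<1+n _
  in-band {2 , leaf i} (here refl , i∈)                 =
    z≤n , leaf-upper (4 * (4 + t) + 2) 2 (proj₂ (∈-interval⁻ 0 _ i∈)) (<-by 5 (e t))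
    where e : ∀ t → suc (4 * (4 + t) + 2 + 2 * (4 + t) + 5) ≡ 6 * (4 + t) + 8
          e = solve-∀
  in-band {3 , leaf i} (there (here refl) , i∈)         =
    leaf-lower (10 * (4 + t) + 8) 4 (proj₁ (∈-interval⁻ 0 _ i∈)) (≤-reflexive (e₁ t)) ,
    leaf-upper (10 * (4 + t) + 8) 4 (proj₂ (∈-interval⁻ 0 _ i∈)) (<-by (t * t + 5 * t + 3) (e₂ t))
    where e₁ : ∀ t → 10 * (4 + t) + 12 ≡ 10 * (4 + t) + 8 + 4 * 1
          e₁ = solve-∀
          e₂ : ∀ t → suc (10 * (4 + t) + 8 + 4 * (4 + t) + (t * t + 5 * t + 3)) ≡ (4 + t) * (4 + t) + 11 * (4 + t) + 8
          e₂ = solve-∀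
  in-band {4 , leaf i} (there (there (here refl)) , i∈) =
    leaf-lower (6 * (4 + t) + 6) 2 (proj₁ (∈-interval⁻ 0 _ i∈)) (≤-reflexive (e₁ t)) ,
    leaf-upper (6 * (4 + t) + 6) 2 (proj₂ (∈-interval⁻ 0 _ i∈)) (<-by (2 * t + 13) (e₂ t))
    where e₁ : ∀ t → 6 * (4 + t) + 8 ≡ 6 * (4 + t) + 6 + 2 * 1
          e₁ = solve-∀
          e₂ : ∀ t → suc (6 * (4 + t) + 6 + 2 * (4 + t) + (2 * t + 13)) ≡ 10 * (4 + t) + 12
          e₂ = solve-∀

  doubledWeight-injective : ∀ {x y} → IsClass (4 + t) x → IsClass (4 + t) y →
                            doubledWeight (4 + t) x ≡ doubledWeight (4 + t) y → x ≡ y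
  doubledWeight-injective =
    injective-by-bands (IsClass (4 + t)) (doubledWeight (4 + t)) band (bandBound (4 + t)) bandBound-step in-band
      same-band-injective

-- Row a labels the centre m by centreLabel a and the leaf 2i by leafOffset a + i, so that the
-- leaves of row 3, the leaves of row 2, the centres of rows 2 and 3, the leaves of row 4 and the
-- centre of row 4 receive consecutive blocks of 1, …, 3n + 3.
module Labelling (n : ℕ) where

  centreLabel : ℕ → ℕ
  centreLabel 2 = suc (n + n)
  centreLabel 3 = suc (suc (n + n))
  centreLabel 4 = suc (suc (suc (n + n)) + n)
  centreLabel _ = 0

  leafOffset : ℕ → ℕ
  leafOffset 2 = n
  leafOffset 3 = 0
  leafOffset 4 = suc (suc (n + n))
  leafOffset _ = 0

  label : ℕ × ℕ → ℕ
  label (a , b) = if does (b ≟ suc n) then centreLabel a else leafOffset a + ⌊ b /2⌋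

  labelAt : ℕ → StarVertex → ℕ
  labelAt a centre   = centreLabel a
  labelAt a (leaf i) = leafOffset a + i

  labelCount : ℕ
  labelCount = n + (n + (2 + (n + 1)))

  interval-blocks : interval 0 labelCount ≡
                    interval 0 n ++ interval n n ++ centreLabel 2 ∷ centreLabel 3 ∷ interval (leafOffset 4) n ++ [ centreLabel 4 ]
  interval-blocks = begin
    interval 0 (n + (n + (2 + (n + 1))))                            ≡⟨ interval-++ 0 n _ ⟩
    interval 0 n ++ interval n (n + (2 + (n + 1)))                  ≡⟨ cong (interval 0 n ++_) (interval-++ n n _) ⟩
    interval 0 n ++ interval n n ++ interval (n + n) (2 + (n + 1))  ≡⟨ cong (λ xs → interval 0 n ++ interval n n ++ centreLabel 2 ∷ centreLabel 3 ∷ xs)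
                                                                            (interval-++ (leafOffset 4) n 1) ⟩
    interval 0 n ++ interval n n ++ centreLabel 2 ∷ centreLabel 3 ∷ interval (leafOffset 4) n ++ [ centreLabel 4 ] ∎
    where open ≡-Reasoning

-- Γ(ℤ₆) × Γ(ℤ₂ₘ) for an odd prime m = n + 1

module TwiceOddPrime (n : ℕ) (m-prime : Prime (suc n)) (m-odd : ¬ 2 ∣ suc n) where
  open Labelling n

  m : ℕ
  m = suc n

  H G : Graph
  H = Γℤ (2 * m)
  G = Γℤ 6 □ H

  leaves : List ℕ
  leaves = map (2 *_) (interval 0 n)

  m∤2 : ¬ m ∣ 2
  m∤2 m∣2 with prime⇒irreducible prime[2] m∣2
  ... | inj₁ m≡1 = ¬prime[1] (subst Prime m≡1 m-prime)
  ... | inj₂ m≡2 = m-odd (subst (2 ∣_) (sym m≡2) ∣-refl)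

  m∤2i : ∀ {i} → 0 < i → i < m → ¬ m ∣ 2 * i
  m∤2i {i} 0<i i<m m∣2i with euclidsLemma 2 i m-prime m∣2i
  ... | inj₁ m∣2 = m∤2 m∣2
  ... | inj₂ m∣i = <⇒≱ i<m (∣⇒≤ {{>-nonZero 0<i}} m∣i)

  2i≢m : ∀ i → 2 * i ≢ m
  2i≢m i 2i≡m = m-odd (subst (2 ∣_) 2i≡m (m∣m*n i))

  m<2m : m < 2 * m
  m<2m = m<m+n m z<s

  2<2m : 2 < 2 * m
  2<2m = ≤-trans (s≤s (s≤s (s≤s z≤n))) (*-monoʳ-≤ 2 (nonTrivial⇒n>1 m {{prime⇒nonTrivial m-prime}}))

  0<i≤n : ∀ {i} → i ∈ interval 0 n → 0 < i × i ≤ n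
  0<i≤n = ∈-interval⁻ 0 n

  2m∣2i*m : ∀ i → 2 * m ∣ 2 * i * m
  2m∣2i*m i = *-pres-∣ (m∣m*n {2} i) (∣-refl {m})

  centre∼leaf : ∀ {x} → x ∈ leaves → adj H m x ≡ true
  centre∼leaf x∈ with ∈-map⁻ (2 *_) x∈
  ... | i , _ , refl = Γℤ-adj⁺ {2 * m} {m} (2i≢m i ∘ sym) (subst (2 * m ∣_) (*-comm (2 * i) m) (2m∣2i*m i))

  leaf∼centre : ∀ {x} → x ∈ leaves → adj H x m ≡ true
  leaf∼centre x∈ with ∈-map⁻ (2 *_) x∈
  ... | i , _ , refl = Γℤ-adj⁺ {2 * m} {2 * i} (2i≢m i) (2m∣2i*m i)

  leaf≁leaf : ∀ {x y} → x ∈ leaves → y ∈ leaves → adj H x y ≡ false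
  leaf≁leaf x∈ y∈ with ∈-map⁻ (2 *_) x∈ | ∈-map⁻ (2 *_) y∈
  ... | i , i∈ , refl | j , j∈ , refl = Γℤ-adj⁻ {2 * m} {2 * i} {2 * j} λ 2m∣2i*2j →
    case euclidsLemma (2 * i) (2 * j) m-prime (∣-trans (n∣m*n 2 {m}) 2m∣2i*2j) of λ where
      (inj₁ m∣2i) → m∤2i (proj₁ (0<i≤n i∈)) (s≤s (proj₂ (0<i≤n i∈))) m∣2i
      (inj₂ m∣2j) → m∤2i (proj₁ (0<i≤n j∈)) (s≤s (proj₂ (0<i≤n j∈))) m∣2j

  centre∈H : m ∈ vertices H
  centre∈H = ∈-Γℤ⁺ 2 z<s m<2m z<s 2<2m (∣-reflexive (*-comm 2 m))

  leaf∈H : ∀ {i} → i ∈ interval 0 n → 2 * i ∈ vertices H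
  leaf∈H {i} i∈ = ∈-Γℤ⁺ m (*-monoʳ-< 2 (proj₁ (0<i≤n i∈))) (*-monoʳ-< 2 (s≤s (proj₂ (0<i≤n i∈)))) z<s m<2m (2m∣2i*m i)

  ∈-H⁺ : ∀ {b} → b ∈ m ∷ leaves → b ∈ vertices H
  ∈-H⁺ (here refl) = centre∈H
  ∈-H⁺ (there b∈) with ∈-map⁻ (2 *_) b∈
  ... | i , i∈ , refl = leaf∈H i∈

  -- An odd zero-divisor b ≠ m would need m ∣ y for its witness y, so y = m and 2 ∣ b.
  ∈-H⁻ : ∀ {b} → b ∈ vertices H → b ∈ m ∷ leaves
  ∈-H⁻ {b} b∈ with ∈-Γℤ⁻ b∈
  ... | 0<b , b<2m , y , 0<y , y<2m , 2m∣by with 2 ∣? b | b ≟ m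
  ...   | yes (divides i refl) | _ =
    there (subst (_∈ leaves) (*-comm 2 i) (∈-map⁺ (2 *_) (∈-interval⁺ 0 n (0<i i 0<b) i≤n)))
    where
    0<i : ∀ i → 0 < i * 2 → 0 < i
    0<i (suc i) _ = z<s
    i≤n : i ≤ n
    i≤n = ≤-pred (*-cancelˡ-< 2 i m (subst (_< 2 * m) (*-comm i 2) b<2m))
  ...   | no _   | yes b≡m = here b≡m
  ...   | no 2∤b | no b≢m with euclidsLemma b y m-prime (∣-trans (n∣m*n 2) 2m∣by)
  ...     | inj₁ m∣b = contradiction (m∣n∧0<n<2m⇒n≡m m∣b 0<b b<2m) b≢m
  ...     | inj₂ m∣y with m∣n∧0<n<2m⇒n≡m m∣y 0<y y<2m
  ...       | refl = contradiction (*-cancelʳ-∣ m 2m∣by) 2∤b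

  m∷leaves-unique : Unique (m ∷ leaves)
  m∷leaves-unique = All.tabulate m≢leaf ∷ Unique.map⁺ (*-cancelˡ-≡ _ _ 2) (interval-unique 0 n)
    where
    m≢leaf : ∀ {x} → x ∈ leaves → m ≢ x
    m≢leaf x∈ m≡x with ∈-map⁻ (2 *_) x∈
    ... | i , _ , refl = 2i≢m i (sym m≡x)

  H-vertices↭ : vertices H ↭ m ∷ leaves
  H-vertices↭ = same-elements⇒↭ (Γℤ-unique (2 * m)) m∷leaves-unique ∈-H⁻ ∈-H⁺

  open Star H m leaves H-vertices↭ (Γℤ-irreflexive (2 * m) m) centre∼leaf leaf∼centre leaf≁leaf

  embed : StarVertex → ℕ
  embed centre   = m
  embed (leaf i) = 2 * i

  embed-∈ : ∀ {c} → IsStarVertex n c → embed c ∈ vertices H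
  embed-∈ {centre} _  = centre∈H
  embed-∈ {leaf i} i∈ = leaf∈H i∈

  classify : ∀ {u} → u ∈ vertices G → ∃[ x ] IsClass n x × u ≡ (proj₁ x , embed (proj₂ x))
  classify {a , b} u∈ with ∈-cartesianProduct⁻ (vertices (Γℤ 6)) (vertices H) u∈
  ... | a∈ , b∈ with ∈-H⁻ b∈
  ...   | here refl = (a , centre) , (a∈ , tt) , refl
  ...   | there b∈leaves with ∈-map⁻ (2 *_) b∈leaves
  ...     | i , i∈ , refl = (a , leaf i) , (a∈ , i∈) , refl

  label-centre : ∀ a → label (a , m) ≡ centreLabel a
  label-centre a = cong (if_then centreLabel a else leafOffset a + ⌊ m /2⌋) (dec-true (m ≟ m) refl)

  label-leaf : ∀ a i → label (a , 2 * i) ≡ leafOffset a + i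
  label-leaf a i = trans (cong (if_then centreLabel a else leafOffset a + ⌊ 2 * i /2⌋) (dec-false (2 * i ≟ m) (2i≢m i)))
                         (cong (leafOffset a +_) ⌊2i/2⌋≡i)
    where
    ⌊2i/2⌋≡i : ⌊ 2 * i /2⌋ ≡ i
    ⌊2i/2⌋≡i = trans (cong (λ j → ⌊ i + j /2⌋) (+-identityʳ i)) (sym (n≡⌊n+n/2⌋ i))

  label-embed : ∀ a c → label (a , embed c) ≡ labelAt a c
  label-embed a centre   = label-centre a
  label-embed a (leaf i) = label-leaf a i

  leaf-labels : ∀ a → map (λ b → label (a , b)) leaves ≡ interval (leafOffset a) n
  leaf-labels a = begin
    map (λ b → label (a , b)) (map (2 *_) (interval 0 n)) ≡⟨ map-∘ (interval 0 n) ⟨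
    map (λ i → label (a , 2 * i)) (interval 0 n)          ≡⟨ map-cong (label-leaf a) (interval 0 n) ⟩
    map (leafOffset a +_) (interval 0 n)                  ≡⟨ map-+-interval (leafOffset a) 0 n ⟩
    interval (leafOffset a + 0) n                         ≡⟨ cong (λ s → interval s n) (+-identityʳ (leafOffset a)) ⟩
    interval (leafOffset a) n                             ∎
    where open ≡-Reasoning

  row-labels : ∀ a → map (λ b → label (a , b)) (vertices H) ↭ centreLabel a ∷ interval (leafOffset a) n
  row-labels a = ↭-trans (↭.map⁺ _ H-vertices↭) (↭-reflexive (cong₂ _∷_ (label-centre a) (leaf-labels a)))

  labels↭interval : map label (vertices G) ↭ interval 0 labelCount
  labels↭interval = begin
    map label (vertices G)
      ≡⟨ map-cartesianProduct label (vertices (Γℤ 6)) (vertices H) ⟩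
    map (λ b → label (2 , b)) (vertices H) ++ map (λ b → label (3 , b)) (vertices H) ++ map (λ b → label (4 , b)) (vertices H) ++ []
      ↭⟨ ↭.++⁺ (row-labels 2) (↭.++⁺ (row-labels 3) (↭.++⁺ (row-labels 4) ↭-refl)) ⟩
    (centreLabel 2 ∷ interval n n) ++ (centreLabel 3 ∷ interval 0 n) ++ (centreLabel 4 ∷ interval (leafOffset 4) n) ++ []
      ↭⟨ rearrange (centreLabel 2) (centreLabel 3) (centreLabel 4) (interval n n) (interval 0 n) (interval (leafOffset 4) n) ⟩
    interval 0 n ++ interval n n ++ centreLabel 2 ∷ centreLabel 3 ∷ interval (leafOffset 4) n ++ [ centreLabel 4 ]
      ≡⟨ interval-blocks ⟨
    interval 0 labelCount ∎
    where open PermutationReasoning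

  label-isLabeling : IsLabeling G label
  label-isLabeling = ↭-trans labels↭interval (↭-reflexive (begin
    interval 0 labelCount                 ≡⟨ upTo-interval labelCount ⟨
    map suc (upTo labelCount)             ≡⟨ cong (map suc ∘ upTo) labelCount≡ ⟩
    map suc (upTo (length (vertices G)))  ∎))
    where
    open ≡-Reasoning
    labelCount≡ : labelCount ≡ length (vertices G)
    labelCount≡ = begin
      labelCount                       ≡⟨ length-interval 0 labelCount ⟨
      length (interval 0 labelCount)   ≡⟨ ↭.↭-length labels↭interval ⟨
      length (map label (vertices G))  ≡⟨ length-map label (vertices G) ⟩
      length (vertices G)              ∎

  rowWeight : ℕ → StarVertex → ℕ
  rowWeight a centre   = sum (interval (leafOffset a) n)
  rowWeight a (leaf _) = centreLabel a

  weight-in-row : ∀ a {c} → IsStarVertex n c → weight H (λ b → label (a , b)) (embed c) ≡ rowWeight a c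
  weight-in-row a {centre} _  = trans (weight-centre _) (cong sum (leaf-labels a))
  weight-in-row a {leaf i} i∈ = trans (weight-leaf _ (∈-map⁺ (2 *_) i∈)) (label-centre a)

  weight-formula : ∀ {a c} → a ∈ vertices (Γℤ 6) → IsStarVertex n c →
                   weight G label (a , embed c) ≡ rowWeight a c + weight (Γℤ 6) (λ x → labelAt x c) a
  weight-formula {a} {c} a∈ c∈ = begin
    weight G label (a , embed c)
      ≡⟨ weight-□ (Γℤ 6) H label (Γℤ-unique 6) (Γℤ-unique (2 * m)) a∈ (embed-∈ c∈) (Γℤ-irreflexive 6 a) ⟩
    weight H (λ b → label (a , b)) (embed c) + weight (Γℤ 6) (λ x → label (x , embed c)) a
      ≡⟨ cong₂ _+_ (weight-in-row a c∈) (weight-cong (Γℤ 6) (λ x → label-embed x c) a) ⟩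
    rowWeight a c + weight (Γℤ 6) (λ x → labelAt x c) a ∎
    where open ≡-Reasoning

  doubled-weight : ∀ {a c} → a ∈ vertices (Γℤ 6) → IsStarVertex n c →
                   2 * weight G label (a , embed c) ≡ doubledWeight n (a , c)
  doubled-weight {a} {c} a∈ c∈ = trans (cong (2 *_) (weight-formula a∈ c∈)) (doubled a∈ c)
    where
    twice-centre : ∀ s k → 2 * (sum (interval s n) + k) ≡ n * suc (s + s + n) + 2 * k
    twice-centre s k = trans (*-distribˡ-+ 2 (sum (interval s n)) k) (cong (_+ 2 * k) (sum-interval s n))
    doubled : ∀ {a} → a ∈ vertices (Γℤ 6) → ∀ c →
              2 * (rowWeight a c + weight (Γℤ 6) (λ x → labelAt x c) a) ≡ doubledWeight n (a , c)
    doubled (here refl) centre = trans (twice-centre n _) (e n)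
      where e : ∀ n → n * suc (n + n + n) + 2 * (suc (suc (n + n)) + 0) ≡ 3 * n * n + 5 * n + 4
            e = solve-∀
    doubled (there (here refl)) centre = trans (twice-centre 0 _) (e n)
      where e : ∀ n → n * suc n + 2 * (suc (n + n) + (suc (suc (suc (n + n)) + n) + 0)) ≡ n * n + 11 * n + 8
            e = solve-∀
    doubled (there (there (here refl))) centre = trans (twice-centre (suc (suc (n + n))) _) (e n)
      where e : ∀ n → n * suc (suc (suc (n + n)) + suc (suc (n + n)) + n) + 2 * (suc (suc (n + n)) + 0) ≡ 5 * n * n + 9 * n + 4
            e = solve-∀
    doubled (here refl) (leaf i) = e n i
      where e : ∀ n i → 2 * (suc (n + n) + (i + 0)) ≡ 4 * n + 2 + 2 * i
            e = solve-∀
    doubled (there (here refl)) (leaf i) = e n i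
      where e : ∀ n i → 2 * (suc (suc (n + n)) + (n + i + (suc (suc (n + n)) + i + 0))) ≡ 10 * n + 8 + 4 * i
            e = solve-∀
    doubled (there (there (here refl))) (leaf i) = e n i
      where e : ∀ n i → 2 * (suc (suc (suc (n + n)) + n) + (i + 0)) ≡ 6 * n + 6 + 2 * i
            e = solve-∀

  distinct-weights : (∀ {x y} → IsClass n x → IsClass n y → doubledWeight n x ≡ doubledWeight n y → x ≡ y) →
                     HasDistinctWeights G label
  distinct-weights doubledWeight-injective u v u∈ v∈ u≢v w≡ with classify u∈ | classify v∈
  ... | (a , c) , (a∈ , c∈) , refl | (a′ , c′) , (a′∈ , c′∈) , refl =
    u≢v (cong (λ x → proj₁ x , embed (proj₂ x)) (doubledWeight-injective (a∈ , c∈) (a′∈ , c′∈) (begin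
      doubledWeight n (a , c)             ≡⟨ doubled-weight a∈ c∈ ⟨
      2 * weight G label (a , embed c)    ≡⟨ cong (2 *_) w≡ ⟩
      2 * weight G label (a′ , embed c′)  ≡⟨ doubled-weight a′∈ c′∈ ⟩
      doubledWeight n (a′ , c′)           ∎)))
    where open ≡-Reasoning

-- For m = 3 the centre of row 3 is not separated from the leaves of row 3, so the nine weights are
-- compared by evaluation.
weights-distinct : ∀ n → Prime (suc n) → (m-odd : ¬ 2 ∣ suc n) →
                   HasDistinctWeights (Γℤ 6 □ Γℤ (2 * suc n)) (Labelling.label n)
weights-distinct 0 p _     = contradiction p ¬prime[1]
weights-distinct 1 _ m-odd = contradiction (divides 1 refl) m-odd
weights-distinct 2 _ _ u v u∈ v∈ u≢v w≡ = u≢v (unique-map⇒injective (from-yes (unique? weights)) u∈ v∈ w≡)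
  where
  G = Γℤ 6 □ Γℤ 6
  weights = map (weight G (Labelling.label 2)) (vertices G)
weights-distinct 3 _ m-odd = contradiction (divides 2 refl) m-odd
weights-distinct (suc (suc (suc (suc t)))) p m-odd =
  TwiceOddPrime.distinct-weights (4 + t) p m-odd (doubledWeight-injective t)

theorem2p10 : (m : ℕ) → Prime m → ¬ m ≡ 2 → AdmitsDAML (Γℤ 6 □ Γℤ (2 * m))
theorem2p10 zero    p     = contradiction p ¬prime[0]
theorem2p10 (suc n) p m≢2 =
  Labelling.label n , TwiceOddPrime.label-isLabeling n p m-odd , weights-distinct n p m-odd
  where
  m-odd : ¬ 2 ∣ suc n
  m-odd = prime≢2⇒odd p m≢2
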